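{- Let $G$ be a graph and let $\mathcal{P}=\{\mathcal{P}(v)\colon v\in V_G\}$ be a family where each $\mathcal{P}(v)$ is a partition of the open neighborhood $N_G(v)$. Then $\gamma(G\circ\mathcal{P})=|V_G|$.
   Context: All graphs are finite and simple; $N_G(v)$ is the set of neighbors of $v$. For such a family $\mathcal{P}$, the $\mathcal{P}$-corona $G\circ\mathcal{P}$ is the graph with vertex set $\{(v,1)\colon v\in V_G\}\cup\bigcup_{v\in V_G}\{(v,A)\colon A\in\mathcal{P}(v)\}$ and edge set $\bigcup_{v\in V_G}\{(v,1)(v,A)\colon A\in\mathcal{P}(v)\}\cup\bigcup_{uv\in E_G}\{(v,A)(u,B)\colon u\in A,\ v\in B\}$ (here $A\in\mathcal{P}(v)$, $B\in\mathcal{P}(u)$). A dominating set of a graph $H$ is a set $D\subseteq V_H$ such that every vertex of $V_H-D$ has a neighbor in $D$; $\gamma(H)$ is the minimum cardinality of a dominating set of $H$. -}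

module Defs where

open import Data.Nat using (ℕ; _≤_)
open import Data.Fin using (Fin)
open import Data.Bool using (Bool; T)
open import Data.Sum using (_⊎_; inj₁; inj₂)
open import Data.Product using (Σ; ∃; ∃-syntax; _×_; _,_)
open import Data.List using (List; length)
open import Data.List.Membership.Propositional using (_∈_)
open import Data.List.Relation.Unary.Unique.Propositional using (Unique)
open import Relation.Binary.PropositionalEquality using (_≡_)
open import Relation.Nullary using (¬_)

record Graph (n : ℕ) : Set where
  field
    adj     : Fin n → Fin n → Bool
    sym     : ∀ u v → adj u v ≡ adj v u
    irrefl  : ∀ v → ¬ T (adj v v)

-- The blocks of P(v) are labelled by Fin (nblocks v); every
-- neighbour u of v lies in exactly one block, namely  block v u p ; every
-- block is nonempty (surjectivity).
record NbhdPartition {n : ℕ} (G : Graph n) : Set where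
  open Graph G
  field
    nblocks  : Fin n → ℕ
    block    : (v u : Fin n) → T (adj v u) → Fin (nblocks v)
    nonempty : ∀ v (i : Fin (nblocks v)) →
               ∃[ u ] Σ (T (adj v u)) (λ p → block v u p ≡ i)

module _ {n : ℕ} {G : Graph n} (P : NbhdPartition G) where
  open Graph G
  open NbhdPartition P

  -- vertices of G ∘ P : (v,1) is  inj₁ v ,  (v,A) is  inj₂ (v , A)
  CoronaV : Set
  CoronaV = Fin n ⊎ Σ (Fin n) (λ v → Fin (nblocks v))

  data CoronaAdj : CoronaV → CoronaV → Set where
    hub-leaf : ∀ v A → CoronaAdj (inj₁ v) (inj₂ (v , A))
    leaf-hub : ∀ v A → CoronaAdj (inj₂ (v , A)) (inj₁ v)
    leaf-leaf : ∀ v u A B (p : T (adj v u)) (q : T (adj u v)) →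
                block v u p ≡ A → block u v q ≡ B →
                CoronaAdj (inj₂ (v , A)) (inj₂ (u , B))

IsDominating : {V : Set} → (V → V → Set) → List V → Set
IsDominating {V} E D = ∀ (x : V) → ¬ (x ∈ D) → ∃[ y ] (y ∈ D × E x y)

DominationNumberIs : {V : Set} → (V → V → Set) → ℕ → Set
DominationNumberIs {V} E m =
  (∃[ D ] (Unique D × IsDominating E D × length D ≡ m)) ×
  (∀ (D : List V) → Unique D → IsDominating E D → m ≤ length D)

-- Each hub (v,1) of G ∘ P is adjacent only to the leaves (v,A), so a dominating
-- set must contain, for every vertex v of G, either (v,1) or some (v,A): it meets
-- each of the n pairwise disjoint fibres over V_G, hence has at least n elements.
-- Conversely the n hubs dominate, since every leaf (v,A) is adjacent to (v,1).
module Submission where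

open import Defs
open import Data.Nat using (ℕ; _≤_)
open import Data.Nat.Properties using (≮⇒≥)
open import Data.Fin using (Fin)
import Data.Fin.Properties as Fin
open import Data.Sum using (inj₁; inj₂)
import Data.Sum.Properties as Sum
open import Data.Product using (_,_)
import Data.Product.Properties as Product
open import Data.List using (List; length; map; allFin; lookup)
open import Data.List.Properties using (length-map; length-tabulate)
open import Data.List.Relation.Unary.Any as Any using (Any)
open import Data.List.Relation.Unary.Any.Properties using (lookup-index)
open import Data.List.Membership.Propositional using (_∈_)
open import Data.List.Membership.Propositional.Properties using (∈-map⁺; ∈-allFin)
open import Data.List.Relation.Unary.Unique.Propositional using (Unique)
import Data.List.Relation.Unary.Unique.Propositional.Properties as Unique
open import Relation.Binary.PropositionalEquality using (_≡_; refl; sym; trans; cong; module ≡-Reasoning)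
open import Relation.Nullary using (Dec; yes; no)
open import Data.Empty using (⊥-elim)
open import Function using (_∘_)

covers⇒≤length : ∀ {n} {A : Set} (f : A → Fin n) (xs : List A) →
                 (∀ i → Any (λ x → f x ≡ i) xs) → n ≤ length xs
covers⇒≤length f xs covers = ≮⇒≥ λ n<len →
  let (i , j , i<j , same-index) = Fin.pigeonhole n<len (Any.index ∘ covers)
      i≡j = begin
        i                                     ≡⟨ sym (lookup-index (covers i)) ⟩
        f (lookup xs (Any.index (covers i)))  ≡⟨ cong (f ∘ lookup xs) same-index ⟩
        f (lookup xs (Any.index (covers j)))  ≡⟨ lookup-index (covers j) ⟩
        j                                     ∎
  in Fin.<-irrefl i≡j i<j
  where open ≡-Reasoning

module _ {n : ℕ} {G : Graph n} (P : NbhdPartition G) where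

  owner : CoronaV P → Fin n
  owner (inj₁ v)       = v
  owner (inj₂ (v , _)) = v

  hubs : List (CoronaV P)
  hubs = map inj₁ (allFin n)

  length-hubs : length hubs ≡ n
  length-hubs = trans (length-map inj₁ (allFin n)) (length-tabulate {n = n} (λ i → i))

  hubs-unique : Unique hubs
  hubs-unique = Unique.map⁺ (λ { refl → refl }) (Unique.allFin⁺ n)

  hub∈hubs : ∀ v → inj₁ v ∈ hubs
  hub∈hubs v = ∈-map⁺ inj₁ (∈-allFin v)

  hubs-dominating : IsDominating (CoronaAdj P) hubs
  hubs-dominating (inj₁ v)       hub∉hubs = ⊥-elim (hub∉hubs (hub∈hubs v))
  hubs-dominating (inj₂ (v , A)) _        = inj₁ v , hub∈hubs v , leaf-hub v A

  owner-neighbour-hub : ∀ {v y} → CoronaAdj P (inj₁ v) y → owner y ≡ v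
  owner-neighbour-hub (hub-leaf v A) = refl

  _≟_ : (x y : CoronaV P) → Dec (x ≡ y)
  _≟_ = Sum.≡-dec Fin._≟_ (Product.≡-dec Fin._≟_ Fin._≟_)

  open import Data.List.Membership.DecPropositional _≟_ using (_∈?_)

  dominating-meets-every-fibre : ∀ D → IsDominating (CoronaAdj P) D →
                                 ∀ v → Any (λ y → owner y ≡ v) D
  dominating-meets-every-fibre D dom v with inj₁ v ∈? D
  ... | yes hub∈D = Any.map (λ { refl → refl }) hub∈D
  ... | no  hub∉D with dom (inj₁ v) hub∉D
  ...   | y , y∈D , hub~y = Any.map (λ { refl → owner-neighbour-hub hub~y }) y∈D

lemma2p11 : (n : ℕ) (G : Graph n) (P : NbhdPartition G) →
            DominationNumberIs (CoronaAdj P) n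
lemma2p11 n G P =
    (hubs P , hubs-unique P , hubs-dominating P , length-hubs P)
  , λ D _ dom → covers⇒≤length (owner P) D (dominating-meets-every-fibre P D dom)
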